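{- If $G$ is a 2-connected graph that does not contain a propeller as an induced subgraph and has no $K_2$-cutset, then every $I$-cutset of $G$ is proper, i.e., no node of $G\setminus\{u,v,w\}$ has at least two neighbors in the $I$-cutset $\{u,v,w\}$.
   Context: All graphs are finite, simple and undirected. A propeller $(C,x)$ is a graph consisting of a chordless cycle $C$ (the rim) and a node $x\notin V(C)$ (the center) that has at least two neighbors on $C$. A graph is 2-connected if removing fewer than 2 nodes never leaves a disconnected graph or a single node. A $K_2$-cutset is a set $\{a,b\}$ with $ab\in E(G)$ such that $G\setminus\{a,b\}$ is disconnected. A 3-set $\{u,v,w\}$ is an $I$-cutset if $G[\{u,v,w\}]$ contains exactly one edge and there is a partition $(\{u,v,w\},K',K'')$ of $V(G)$ such that no edge joins $K'$ and $K''$, some connected component of $G[K']$ contains a neighbor of each of $u,v,w$, and some connected component of $G[K'']$ contains a neighbor of each of $u,v,w$. -}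

module Defs where

open import Data.Nat using (ℕ; suc; _≥_)
open import Data.Fin using (Fin; toℕ)
open import Data.Product using (Σ; ∃; _×_; _,_)
open import Data.Sum using (_⊎_)
open import Data.Empty using (⊥)
open import Data.Unit using (⊤)
open import Relation.Nullary using (¬_; Dec)
open import Relation.Binary.PropositionalEquality using (_≡_; _≢_)
open import Function.Definitions using (Injective)
open import Function.Bundles using (_⇔_)

record Graph : Set₁ where
  field
    n      : ℕ
    E      : Fin n → Fin n → Set
    E-sym  : ∀ {x y} → E x y → E y x
    E-irr  : ∀ {x} → ¬ E x x
    E-dec  : ∀ x y → Dec (E x y)

module _ (G : Graph) where
  open Graph G

  V : Set
  V = Fin n

  data Walk (S : V → Set) : V → V → Set where
    here : ∀ {x} → S x → Walk S x x
    step : ∀ {x y z} → S x → E x y → Walk S y z → Walk S x z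

  ConnectedAtLeast2 : (V → Set) → Set
  ConnectedAtLeast2 S =
    (Σ V λ x → Σ V λ y → S x × S y × x ≢ y)
    × (∀ x y → S x → S y → Walk S x y)

  Disconnected : (V → Set) → Set
  Disconnected S = Σ V λ x → Σ V λ y → S x × S y × ¬ Walk S x y

  -- Removing fewer than 2 nodes never leaves a disconnected graph or a single
  -- node (nor the empty graph).
  TwoConnected : Set
  TwoConnected =
    ConnectedAtLeast2 (λ _ → ⊤) × (∀ v → ConnectedAtLeast2 (λ x → x ≢ v))

  K2Cutset : V → V → Set
  K2Cutset a b = E a b × Disconnected (λ x → x ≢ a × x ≢ b)

  HasK2Cutset : Set
  HasK2Cutset = Σ V λ a → Σ V λ b → K2Cutset a b

  Consec : ∀ {k} → Fin k → Fin k → Set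
  Consec {k} i j = (suc (toℕ i) ≡ toℕ j) ⊎ (suc (toℕ i) ≡ k × toℕ j ≡ 0)

  ChordlessCycle : (k : ℕ) → (Fin k → V) → Set
  ChordlessCycle k c =
    k ≥ 3 × Injective _≡_ _≡_ c
    × (∀ i j → E (c i) (c j) ⇔ (Consec i j ⊎ Consec j i))

  ContainsPropeller : Set
  ContainsPropeller =
    Σ ℕ λ k → Σ (Fin k → V) λ c → Σ V λ x →
      ChordlessCycle k c
      × (∀ i → c i ≢ x)
      × (Σ (Fin k) λ i → Σ (Fin k) λ j → i ≢ j × E x (c i) × E x (c j))

  ExactlyOneEdge : V → V → V → Set
  ExactlyOneEdge u v w =
    (E u v × ¬ E u w × ¬ E v w)
    ⊎ (¬ E u v × E u w × ¬ E v w)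
    ⊎ (¬ E u v × ¬ E u w × E v w)

  -- Some connected component of G[K] contains a neighbour of each of u, v, w.
  ComponentSeesAll : (V → Set) → V → V → V → Set
  ComponentSeesAll K u v w =
    Σ V λ a → Σ V λ b → Σ V λ c →
      K a × K b × K c × E u a × E v b × E w c
      × Walk K a b × Walk K a c

  ICutset : V → V → V → Set₁
  ICutset u v w =
    u ≢ v × u ≢ w × v ≢ w × ExactlyOneEdge u v w
    × Σ (V → Set) λ K' → Σ (V → Set) λ K'' →
        (∀ x → (x ≡ u ⊎ x ≡ v ⊎ x ≡ w) ⊎ K' x ⊎ K'' x)
        × (∀ x → K' x → x ≢ u × x ≢ v × x ≢ w)
        × (∀ x → K'' x → x ≢ u × x ≢ v × x ≢ w)
        × (∀ x → ¬ (K' x × K'' x))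
        × (∀ x y → K' x → K'' y → ¬ E x y)
        × ComponentSeesAll K' u v w
        × ComponentSeesAll K'' u v w

  ProperICutset : V → V → V → Set
  ProperICutset u v w =
    ∀ y → y ≢ u → y ≢ v → y ≢ w →
      ¬ ((E y u × E y v) ⊎ (E y u × E y w) ⊎ (E y v × E y w))

-- Let y ∈ K′ see two nodes of the I-cutset. Each of K′ and K″ yields induced paths between any
-- two cutset nodes; a path from s towards t through K stops at a neighbour of t, its only one there.
-- If y sees both ends a, b of the edge of the cutset, then a closes a path from b towards a through
-- K″ into a hole with centre y. Otherwise y sees the third node q and an end p of the edge pr.
-- Take paths P from q towards p through K″ and R from r towards q through K′. If r has a neighbour
-- on P, it is the centre of the hole p y q P; if p has a neighbour inside R, it is the centre of the
-- hole r R q W, with W a path from q towards r through K″; otherwise p r R q P is a hole with centre y.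
module Submission where

open import Defs
open import Data.Empty using (⊥-elim)
open import Data.Fin using (Fin; toℕ; fromℕ) renaming (zero to fzero; suc to fsuc)
open import Data.Fin.Properties using (toℕ-injective; toℕ-fromℕ) renaming (_≟_ to _≟ᶠ_)
open import Data.List using (List; []; _∷_; _++_; length; lookup)
open import Data.List.Properties using (++-conicalʳ)
open import Data.List.Membership.Propositional using (_∈_; lose; find)
open import Data.List.Membership.Propositional.Properties using (∈-lookup; ∈-++⁻; ∈-++⁺ˡ; ∈-++⁺ʳ)
open import Data.List.Relation.Binary.Subset.Propositional using (_⊆_)
open import Data.List.Relation.Binary.Subset.Propositional.Properties using (⊆-trans; ∷⁺ʳ; All-resp-⊇)
open import Data.List.Relation.Unary.All as All using (All; []; _∷_)
open import Data.List.Relation.Unary.All.Properties using (++⁺; ¬Any⇒All¬)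
open import Data.List.Relation.Unary.Any as Any using (Any; here; there)
open import Data.List.Relation.Unary.Any.Properties using (lookup-index)
open import Data.List.Relation.Unary.Linked using (Linked; [-]; _∷_)
open import Data.Nat using (suc; _≥_; s≤s; z≤n)
open import Data.Nat.Properties using (suc-injective)
open import Data.Product using (Σ; _×_; _,_; proj₁; proj₂)
open import Data.Sum as Sum using (_⊎_; inj₁; inj₂)
open import Data.Unit using (⊤; tt)
open import Function using (_∘′_; id)
open import Function.Bundles using (_⇔_; mk⇔)
open import Function.Construct.Composition using (_⇔-∘_)
open import Relation.Nullary using (¬_; Dec; yes; no)
open import Relation.Nullary.Decidable using (_⊎-dec_)
open import Relation.Binary.PropositionalEquality using (_≡_; _≢_; refl; sym; trans; cong; subst; ≢-sym)

module _ (G : Graph) where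
  open Graph G

  E⇒≢ : ∀ {x y} → E x y → x ≢ y
  E⇒≢ e refl = E-irr e

  apart : {A B : V G → Set} → (∀ {z} → A z → ¬ B z) → ∀ {x z} → A x → B z → x ≢ z
  apart A⇒¬B Ax Bz refl = A⇒¬B Ax Bz

  Far : V G → V G → Set
  Far x z = x ≢ z × ¬ E x z

  InducedPath : List (V G) → Set
  InducedPath []           = ⊤
  InducedPath (x ∷ [])     = ⊤
  InducedPath (x ∷ y ∷ zs) = E x y × All (Far x) zs × InducedPath (y ∷ zs)

  lastOf : V G → List (V G) → V G
  lastOf x []       = x
  lastOf x (y ∷ ys) = lastOf y ys

  lastOf∈ : ∀ x xs → lastOf x xs ∈ x ∷ xs
  lastOf∈ x []       = here refl
  lastOf∈ x (y ∷ ys) = there (lastOf∈ y ys)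

  lastOf-++ : ∀ x xs y ys → lastOf x (xs ++ y ∷ ys) ≡ lastOf y ys
  lastOf-++ x []       y ys = refl
  lastOf-++ x (z ∷ zs) y ys = lastOf-++ z zs y ys

  lookup-lastOf : ∀ h t (j : Fin (length (h ∷ t))) → toℕ j ≡ length t → lookup (h ∷ t) j ≡ lastOf h t
  lookup-lastOf h []       fzero    _ = refl
  lookup-lastOf h (x ∷ xs) (fsuc j) p = lookup-lastOf x xs j (suc-injective p)

  inducedPath-tail : ∀ {x xs} → InducedPath (x ∷ xs) → InducedPath xs
  inducedPath-tail {xs = []}    _            = tt
  inducedPath-tail {xs = _ ∷ _} (_ , _ , ip) = ip

  inducedPath-head-≢ : ∀ {x xs z} → InducedPath (x ∷ xs) → z ∈ xs → x ≢ z
  inducedPath-head-≢ (xy , _     , _) (here refl) = E⇒≢ xy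
  inducedPath-head-≢ (_  , x-far , _) (there m)   = proj₁ (All.lookup x-far m)

  inducedPath-edge⇒consecutive : ∀ L → InducedPath L → ∀ i j → E (lookup L i) (lookup L j) →
    suc (toℕ i) ≡ toℕ j ⊎ suc (toℕ j) ≡ toℕ i
  inducedPath-edge⇒consecutive (x ∷ [])     _ fzero fzero e = ⊥-elim (E-irr e)
  inducedPath-edge⇒consecutive (x ∷ y ∷ zs) _ fzero fzero e = ⊥-elim (E-irr e)
  inducedPath-edge⇒consecutive (x ∷ y ∷ zs) _ fzero (fsuc fzero) _ = inj₁ refl
  inducedPath-edge⇒consecutive (x ∷ y ∷ zs) _ (fsuc fzero) fzero _ = inj₂ refl
  inducedPath-edge⇒consecutive (x ∷ y ∷ zs) (_ , x-far , _) fzero (fsuc (fsuc j)) e =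
    ⊥-elim (proj₂ (All.lookup x-far (∈-lookup j)) e)
  inducedPath-edge⇒consecutive (x ∷ y ∷ zs) (_ , x-far , _) (fsuc (fsuc i)) fzero e =
    ⊥-elim (proj₂ (All.lookup x-far (∈-lookup i)) (E-sym e))
  inducedPath-edge⇒consecutive (x ∷ y ∷ zs) (_ , _ , ip) (fsuc i) (fsuc j) e =
    Sum.map (cong suc) (cong suc) (inducedPath-edge⇒consecutive (y ∷ zs) ip i j e)

  inducedPath-consecutive⇒edge : ∀ L → InducedPath L → ∀ i j → suc (toℕ i) ≡ toℕ j →
    E (lookup L i) (lookup L j)
  inducedPath-consecutive⇒edge (x ∷ y ∷ zs) (xy , _ , _) fzero (fsuc fzero) _ = xy
  inducedPath-consecutive⇒edge (x ∷ y ∷ zs) (_ , _ , ip) (fsuc i) (fsuc j) p =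
    inducedPath-consecutive⇒edge (y ∷ zs) ip i j (suc-injective p)

  inducedPath-lookup-injective : ∀ L → InducedPath L → ∀ i j → lookup L i ≡ lookup L j → i ≡ j
  inducedPath-lookup-injective (x ∷ [])     _  fzero    fzero    _ = refl
  inducedPath-lookup-injective (x ∷ y ∷ zs) _  fzero    fzero    _ = refl
  inducedPath-lookup-injective (x ∷ y ∷ zs) ip fzero    (fsuc j) p =
    ⊥-elim (inducedPath-head-≢ ip (∈-lookup j) p)
  inducedPath-lookup-injective (x ∷ y ∷ zs) ip (fsuc i) fzero    p =
    ⊥-elim (inducedPath-head-≢ ip (∈-lookup i) (sym p))
  inducedPath-lookup-injective (x ∷ y ∷ zs) (_ , _ , ip) (fsuc i) (fsuc j) p =
    cong fsuc (inducedPath-lookup-injective (y ∷ zs) ip i j p)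

  -- The chordless cycle a ∷ h ∷ t, presented as the induced path h ∷ t closed up by the apex a.
  record Hole (a h : V G) (t : List (V G)) : Set where
    field
      induced       : InducedPath (h ∷ t)
      nontrivial    : t ≢ []
      apex-head     : E a h
      apex-last     : E a (lastOf h t)
      apex-interior : ∀ {z} → z ∈ h ∷ t → z ≢ h → z ≢ lastOf h t → Far a z

  module _ {a h t} (H : Hole a h t) where
    open Hole H

    private
      P C : List (V G)
      P = h ∷ t
      C = a ∷ P

    end-or-far : ∀ {z} → z ∈ P → (z ≡ h ⊎ z ≡ lastOf h t) ⊎ Far a z
    end-or-far {z} z∈ with z ≟ᶠ h | z ≟ᶠ lastOf h t
    ... | yes z≡h  | _           = inj₁ (inj₁ z≡h)
    ... | no _     | yes z≡last  = inj₁ (inj₂ z≡last)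
    ... | no z≢h   | no z≢last   = inj₂ (apex-interior z∈ z≢h z≢last)

    apex-edge⇔end : ∀ j → E a (lookup P j) ⇔ (toℕ j ≡ 0 ⊎ toℕ j ≡ length t)
    apex-edge⇔end j = mk⇔ to from
      where
      last-index : lookup P (fromℕ (length t)) ≡ lastOf h t
      last-index = lookup-lastOf h t (fromℕ (length t)) (toℕ-fromℕ (length t))

      to : E a (lookup P j) → toℕ j ≡ 0 ⊎ toℕ j ≡ length t
      to e with end-or-far (∈-lookup j)
      ... | inj₁ (inj₁ j-head) = inj₁ (cong toℕ (inducedPath-lookup-injective P induced j fzero j-head))
      ... | inj₁ (inj₂ j-last) = inj₂ (trans
            (cong toℕ (inducedPath-lookup-injective P induced j _ (trans j-last (sym last-index))))
            (toℕ-fromℕ (length t)))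
      ... | inj₂ (_ , ¬e)      = ⊥-elim (¬e e)

      from : toℕ j ≡ 0 ⊎ toℕ j ≡ length t → E a (lookup P j)
      from (inj₁ p) = subst (E a ∘′ lookup P) (sym (toℕ-injective {j = fzero} p)) apex-head
      from (inj₂ p) = subst (E a ∘′ lookup P) (sym (toℕ-injective (trans p (sym (toℕ-fromℕ (length t))))))
                        (subst (E a) (sym last-index) apex-last)

    hole⇒chordlessCycle : ChordlessCycle G (length C) (lookup C)
    hole⇒chordlessCycle = length≥3 t nontrivial , (λ {i} {j} → injective i j) , edges
      where
      length≥3 : ∀ t → t ≢ [] → length (a ∷ h ∷ t) ≥ 3
      length≥3 []      t≢[] = ⊥-elim (t≢[] refl)
      length≥3 (_ ∷ _) _    = s≤s (s≤s (s≤s z≤n))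

      apex∉ : ∀ j → a ≢ lookup P j
      apex∉ j with end-or-far (∈-lookup j)
      ... | inj₁ (inj₁ j-head) = λ a≡ → E⇒≢ apex-head (trans a≡ j-head)
      ... | inj₁ (inj₂ j-last) = λ a≡ → E⇒≢ apex-last (trans a≡ j-last)
      ... | inj₂ (a≢ , _)      = a≢

      injective : ∀ i j → lookup C i ≡ lookup C j → i ≡ j
      injective fzero    fzero    _ = refl
      injective fzero    (fsuc j) p = ⊥-elim (apex∉ j p)
      injective (fsuc i) fzero    p = ⊥-elim (apex∉ i (sym p))
      injective (fsuc i) (fsuc j) p = cong fsuc (inducedPath-lookup-injective P induced i j p)

      apex-consec : ∀ j → (toℕ j ≡ 0 ⊎ toℕ j ≡ length t) ⇔
                          (Consec G {length C} fzero (fsuc j) ⊎ Consec G (fsuc j) fzero)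
      apex-consec j = mk⇔
        (Sum.map (λ p → inj₁ (cong suc (sym p))) (λ p → inj₂ (cong (suc ∘′ suc) p , refl)))
        λ { (inj₁ (inj₁ p)) → inj₁ (sym (suc-injective p))
          ; (inj₂ (inj₂ (p , _))) → inj₂ (suc-injective (suc-injective p))
          ; (inj₁ (inj₂ (() , _))) ; (inj₂ (inj₁ ())) }

      path-consec : ∀ i j → (suc (toℕ i) ≡ toℕ j ⊎ suc (toℕ j) ≡ toℕ i) ⇔
                            (Consec G {length C} (fsuc i) (fsuc j) ⊎ Consec G (fsuc j) (fsuc i))
      path-consec i j = mk⇔
        (Sum.map (inj₁ ∘′ cong suc) (inj₁ ∘′ cong suc))
        λ { (inj₁ (inj₁ p)) → inj₁ (suc-injective p) ; (inj₂ (inj₁ p)) → inj₂ (suc-injective p)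
          ; (inj₁ (inj₂ (_ , ()))) ; (inj₂ (inj₂ (_ , ()))) }

      edges : ∀ i j → E (lookup C i) (lookup C j) ⇔ (Consec G i j ⊎ Consec G j i)
      edges fzero fzero = mk⇔ (⊥-elim ∘′ E-irr) λ
        { (inj₁ (inj₁ ())) ; (inj₁ (inj₂ (() , _))) ; (inj₂ (inj₁ ())) ; (inj₂ (inj₂ (() , _))) }
      edges fzero (fsuc j) = apex-consec j ⇔-∘ apex-edge⇔end j
      edges (fsuc i) fzero =
        mk⇔ Sum.swap Sum.swap ⇔-∘ (apex-consec i ⇔-∘ (apex-edge⇔end i ⇔-∘ mk⇔ E-sym E-sym))
      edges (fsuc i) (fsuc j) = path-consec i j ⇔-∘
        mk⇔ (inducedPath-edge⇒consecutive P induced i j)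
            Sum.[ inducedPath-consecutive⇒edge P induced i j
                , E-sym ∘′ inducedPath-consecutive⇒edge P induced j i ]

    propeller : ∀ x → (∀ {z} → z ∈ C → z ≢ x) → ∀ {z₁ z₂} → z₁ ∈ C → z₂ ∈ C → z₁ ≢ z₂ →
      E x z₁ → E x z₂ → ContainsPropeller G
    propeller x x∉C m₁ m₂ z₁≢z₂ e₁ e₂ =
      length C , lookup C , x , hole⇒chordlessCycle , (λ i → x∉C (∈-lookup i)) ,
      Any.index m₁ , Any.index m₂ ,
      (λ i≡j → z₁≢z₂ (trans (lookup-index m₁) (trans (cong (lookup C) i≡j) (sym (lookup-index m₂))))) ,
      subst (E x) (lookup-index m₁) e₁ , subst (E x) (lookup-index m₂) e₂

  walk⇒linked : ∀ {S x z} → Walk G S x z →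
    Σ (List (V G)) λ xs → Linked E (x ∷ xs) × All S (x ∷ xs) × lastOf x xs ≡ z
  walk⇒linked (here Sx) = [] , [-] , Sx ∷ [] , refl
  walk⇒linked (step Sx e w) with walk⇒linked w
  ... | xs , linked , inS , last = _ ∷ xs , e ∷ linked , Sx ∷ inS , last

  walk-++ : ∀ {S x y z} → Walk G S x y → Walk G S y z → Walk G S x z
  walk-++ (here _)      w′ = w′
  walk-++ (step Sx e w) w′ = step Sx e (walk-++ w w′)

  walk-start : ∀ {S x y} → Walk G S x y → S x
  walk-start (here Sx)     = Sx
  walk-start (step Sx _ _) = Sx

  walk-reverse : ∀ {S x y} → Walk G S x y → Walk G S y x
  walk-reverse (here Sx)     = here Sx
  walk-reverse (step Sx e w) = walk-++ (walk-reverse w) (step (walk-start w) (E-sym e) (here Sx))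

  upToFirst : {D : V G → Set} → (∀ z → Dec (D z)) → ∀ x xs → Linked E (x ∷ xs) → Any D (x ∷ xs) →
    Σ (List (V G)) λ ys → Linked E (x ∷ ys) × ys ⊆ xs × D (lastOf x ys)
      × (∀ {z} → z ∈ x ∷ ys → D z → z ≡ lastOf x ys)
  upToFirst D? x xs linked (here Dx) = [] , [-] , (λ ()) , Dx , λ { (here refl) _ → refl }
  upToFirst D? x (y ∷ ys) (xy ∷ linked) (there found) with D? x
  ... | yes Dx = [] , [-] , (λ ()) , Dx , λ { (here refl) _ → refl }
  ... | no ¬Dx with upToFirst D? y ys linked found
  ...   | zs , linked′ , zs⊆ys , Dlast , first =
    y ∷ zs , xy ∷ linked′ , ∷⁺ʳ y zs⊆ys , Dlast ,
    λ { (here refl) Dz → ⊥-elim (¬Dx Dz) ; (there m) Dz → first m Dz }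

  Touches : V G → V G → Set
  Touches x z = x ≡ z ⊎ E x z

  -- Keep the suffix of p ∷ ps from its last node touching x, with x put in front unless it is that node.
  prepend : ∀ x p ps → InducedPath (p ∷ ps) → Any (Touches x) (p ∷ ps) →
    Σ (List (V G)) λ Q → InducedPath (x ∷ Q) × lastOf x Q ≡ lastOf p ps × Q ⊆ p ∷ ps
  prepend x p ps ip touch with Any.any? (λ z → (x ≟ᶠ z) ⊎-dec E-dec x z) ps
  prepend x p (q ∷ qs) (_ , _ , ip) _ | yes touch with prepend x q qs ip touch
  ... | Q , ipQ , last , Q⊆ = Q , ipQ , last , there ∘′ Q⊆
  prepend x p ps ip (here (inj₁ refl)) | no _ = ps , ip , refl , there
  prepend x p ps ip (here (inj₂ xp)) | no untouched =
    p ∷ ps , (xp , All.map (λ ¬t → ¬t ∘′ inj₁ , ¬t ∘′ inj₂) (¬Any⇒All¬ ps untouched) , ip) , refl , id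
  prepend x p ps ip (there touch) | no untouched = ⊥-elim (untouched touch)

  induce : ∀ x xs → Linked E (x ∷ xs) →
    Σ (List (V G)) λ Q → InducedPath (x ∷ Q) × lastOf x Q ≡ lastOf x xs × Q ⊆ xs
  induce x []       _             = [] , tt , refl , λ ()
  induce x (y ∷ ys) (xy ∷ linked) with induce y ys linked
  ... | Q , ip , last , Q⊆ with prepend x y Q ip (here (inj₂ xy))
  ... | Q′ , ip′ , last′ , Q′⊆ = Q′ , ip′ , trans last′ last , ⊆-trans Q′⊆ (∷⁺ʳ y Q⊆)

  ConnectedVia : (V G → Set) → V G → V G → Set
  ConnectedVia K s t = Σ (V G) λ s′ → Σ (V G) λ t′ → E s s′ × E t t′ × Walk G K s′ t′

  record PathToward (K : V G → Set) (a b : V G) : Set where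
    field
      first             : V G
      rest              : List (V G)
      induced           : InducedPath (a ∷ first ∷ rest)
      inside            : All K (first ∷ rest)
      touches-last      : E b (lastOf first rest)
      touches-only-last : ∀ {z} → z ∈ first ∷ rest → E b z → z ≡ lastOf first rest

  pathToward : ∀ {K a b} → ¬ K a → ConnectedVia K a b → PathToward K a b
  pathToward {K} {a} {b} ¬Ka (s , t , as , bt , w) with walk⇒linked w
  ... | xs , linked , inK , last-t
    with upToFirst (E-dec b) s xs linked (lose (lastOf∈ s xs) (subst (E b) (sym last-t) bt))
  ... | ys , linked′ , ys⊆xs , b-last , only-last with induce a (s ∷ ys) (as ∷ linked′)
  ... | [] , _ , a-last , _ =
    ⊥-elim (¬Ka (subst K (sym a-last) (All.lookup inK (∷⁺ʳ s ys⊆xs (lastOf∈ s ys)))))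
  ... | m ∷ ms , ip , last , Q⊆ = record
    { first             = m
    ; rest              = ms
    ; induced           = ip
    ; inside            = All-resp-⊇ (⊆-trans Q⊆ (∷⁺ʳ s ys⊆xs)) inK
    ; touches-last      = subst (E b) (sym last) b-last
    ; touches-only-last = λ z∈ bz → trans (only-last (Q⊆ z∈) bz) (sym last)
    }

  join : ∀ x xs m ys → InducedPath (x ∷ xs) → InducedPath (m ∷ ys) → E (lastOf x xs) m →
    (∀ {z} → z ∈ x ∷ xs → z ≢ lastOf x xs → Far z m) →
    (∀ {z w} → z ∈ x ∷ xs → w ∈ ys → Far z w) →
    InducedPath (x ∷ xs ++ m ∷ ys)
  join x []       m ys _ ipm xm _ far = xm , All.tabulate (far (here refl)) , ipm
  join x (y ∷ xs) m ys ip@(xy , x-far , ip′) ipm last-m far-m far =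
    xy ,
    ++⁺ x-far (far-m (here refl) (inducedPath-head-≢ ip (lastOf∈ y xs)) ∷ All.tabulate (far (here refl))) ,
    join y xs m ys ip′ ipm last-m (λ z∈ → far-m (there z∈)) (λ z∈ → far (there z∈))

  ∈-++-∷⁻ : ∀ (xs : List (V G)) {q ys z} → z ∈ xs ++ q ∷ ys → z ∈ xs ⊎ z ≡ q ⊎ z ∈ ys
  ∈-++-∷⁻ xs z∈ with ∈-++⁻ xs z∈
  ... | inj₁ z∈xs         = inj₁ z∈xs
  ... | inj₂ (here z≡q)   = inj₂ (inj₁ z≡q)
  ... | inj₂ (there z∈ys) = inj₂ (inj₂ z∈ys)

  -- T plays the role of the I-cutset {u,v,w}, and X, Y of the sides K′, K″.
  record Separation (T X Y : V G → Set) : Set where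
    field
      disjoint   : ∀ {z} → X z → ¬ Y z
      no-edge    : ∀ {x z} → X x → Y z → ¬ E x z
      T∉X        : ∀ {z} → T z → ¬ X z
      T∉Y        : ∀ {z} → T z → ¬ Y z
      X-connects : ∀ {s t} → T s → T t → ConnectedVia X s t
      Y-connects : ∀ {s t} → T s → T t → ConnectedVia Y s t

  Separation-swap : ∀ {T X Y} → Separation T X Y → Separation T Y X
  Separation-swap S = record
    { disjoint   = λ Yz Xz → disjoint Xz Yz
    ; no-edge    = λ Yx Xz e → no-edge Xz Yx (E-sym e)
    ; T∉X        = T∉Y
    ; T∉Y        = T∉X
    ; X-connects = Y-connects
    ; Y-connects = X-connects
    }
    where open Separation S

  module _ {T X Y} (S : Separation T X Y) where
    open Separation S

    private
      X∩T=∅ : ∀ {z} → X z → ¬ T z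
      X∩T=∅ Xz Tz = T∉X Tz Xz

      Y∩T=∅ : ∀ {z} → Y z → ¬ T z
      Y∩T=∅ Yz Tz = T∉Y Tz Yz

      Y∩X=∅ : ∀ {z} → Y z → ¬ X z
      Y∩X=∅ Yz Xz = disjoint Xz Yz

      X-far-Y : ∀ {x z} → X x → Y z → Far x z
      X-far-Y Xx Yz = apart disjoint Xx Yz , no-edge Xx Yz

    edge-case : ∀ {a b y} → T a → T b → X y → E a b → E y a → E y b → ContainsPropeller G
    edge-case {a} {b} {y} Ta Tb Xy ab ya yb =
      propeller hole y y∉C (here refl) (there (here refl)) (E⇒≢ ab) ya yb
      where
      open PathToward (pathToward (T∉Y Tb) (Y-connects Tb Ta))

      hole : Hole a b (first ∷ rest)
      hole = record
        { induced       = induced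
        ; nontrivial    = λ ()
        ; apex-head     = ab
        ; apex-last     = touches-last
        ; apex-interior = λ
          { (here refl) z≢b _    → ⊥-elim (z≢b refl)
          ; (there z∈)  _ z≢last → apart T∉Y Ta (All.lookup inside z∈) , z≢last ∘′ touches-only-last z∈ }
        }

      y∉C : ∀ {z} → z ∈ a ∷ b ∷ first ∷ rest → z ≢ y
      y∉C (here refl)         = apart T∉X Ta Xy
      y∉C (there (here refl)) = apart T∉X Tb Xy
      y∉C (there (there z∈))  = apart Y∩X=∅ (All.lookup inside z∈) Xy

    module NonEdgeCase {p q r y} (Tp : T p) (Tq : T q) (Tr : T r) (Xy : X y) (p≢q : p ≢ q) (q≢r : q ≢ r)
                       (yp : E y p) (yq : E y q) (¬pq : ¬ E p q) (pr : E p r) (¬qr : ¬ E q r)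
                       (P : PathToward Y q p) (R : PathToward X r q) where
      private
        module P = PathToward P
        module R = PathToward R

      R-far-q : ∀ {z} → z ∈ R.first ∷ R.rest → z ≢ lastOf R.first R.rest → Far z q
      R-far-q z∈ z≢last =
        apart X∩T=∅ (All.lookup R.inside z∈) Tq , λ zq → z≢last (R.touches-only-last z∈ (E-sym zq))

      centre-r : ∀ {z} → z ∈ q ∷ P.first ∷ P.rest → E r z → ContainsPropeller G
      centre-r z∈ rz = propeller hole r r∉C (here refl) (there (there z∈)) (p∉ z∈) (E-sym pr) rz
        where
        p∉ : ∀ {x} → x ∈ q ∷ P.first ∷ P.rest → p ≢ x
        p∉ (here refl) = p≢q
        p∉ (there x∈P) = apart T∉Y Tp (All.lookup P.inside x∈P)

        hole : Hole p y (q ∷ P.first ∷ P.rest)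
        hole = record
          { induced       = yq , All.map (X-far-Y Xy) P.inside , P.induced
          ; nontrivial    = λ ()
          ; apex-head     = E-sym yp
          ; apex-last     = P.touches-last
          ; apex-interior = λ
            { (here refl)         z≢y _ → ⊥-elim (z≢y refl)
            ; (there (here refl)) _   _ → p≢q , ¬pq
            ; (there (there z∈P)) _ z≢last →
                apart T∉Y Tp (All.lookup P.inside z∈P) , z≢last ∘′ P.touches-only-last z∈P }
          }

        r∉C : ∀ {x} → x ∈ p ∷ y ∷ q ∷ P.first ∷ P.rest → x ≢ r
        r∉C (here refl)                 = E⇒≢ pr
        r∉C (there (here refl))         = apart X∩T=∅ Xy Tr
        r∉C (there (there (here refl))) = q≢r
        r∉C (there (there (there x∈)))  = apart Y∩T=∅ (All.lookup P.inside x∈) Tr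

      centre-p : (W : PathToward Y q r) → ∀ {z} → z ∈ R.first ∷ R.rest → E p z → ContainsPropeller G
      centre-p W {z} z∈R pz =
        propeller hole p p∉C (here refl) (there (∈-++⁺ˡ z∈R)) (apart T∉X Tr (All.lookup R.inside z∈R)) pr pz
        where
        module W = PathToward W

        last-is-W : lastOf R.first (R.rest ++ q ∷ W.first ∷ W.rest) ≡ lastOf W.first W.rest
        last-is-W = lastOf-++ R.first R.rest q (W.first ∷ W.rest)

        hole : Hole r R.first (R.rest ++ q ∷ W.first ∷ W.rest)
        hole = record
          { induced       = join R.first R.rest q (W.first ∷ W.rest) (inducedPath-tail R.induced) W.induced
                              (E-sym R.touches-last) R-far-q
                              (λ x∈ w∈ → X-far-Y (All.lookup R.inside x∈) (All.lookup W.inside w∈))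
          ; nontrivial    = (λ ()) ∘′ ++-conicalʳ R.rest (q ∷ W.first ∷ W.rest)
          ; apex-head     = proj₁ R.induced
          ; apex-last     = subst (E r) (sym last-is-W) W.touches-last
          ; apex-interior = interior
          }
          where
          interior : ∀ {x} → x ∈ R.first ∷ R.rest ++ q ∷ W.first ∷ W.rest → x ≢ R.first →
                     x ≢ lastOf R.first (R.rest ++ q ∷ W.first ∷ W.rest) → Far r x
          interior (here refl) x≢first _ = ⊥-elim (x≢first refl)
          interior (there x∈) _ x≢last with ∈-++-∷⁻ R.rest x∈
          ... | inj₁ x∈R         = All.lookup (proj₁ (proj₂ R.induced)) x∈R
          ... | inj₂ (inj₁ refl) = ≢-sym q≢r , ¬qr ∘′ E-sym
          ... | inj₂ (inj₂ x∈W)  = apart T∉Y Tr (All.lookup W.inside x∈W) ,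
                                   λ rx → x≢last (trans (W.touches-only-last x∈W rx) (sym last-is-W))

        p∉C : ∀ {x} → x ∈ r ∷ R.first ∷ R.rest ++ q ∷ W.first ∷ W.rest → x ≢ p
        p∉C (here refl) = ≢-sym (E⇒≢ pr)
        p∉C (there x∈) with ∈-++-∷⁻ (R.first ∷ R.rest) x∈
        ... | inj₁ x∈R         = apart X∩T=∅ (All.lookup R.inside x∈R) Tp
        ... | inj₂ (inj₁ refl) = ≢-sym p≢q
        ... | inj₂ (inj₂ x∈W)  = apart Y∩T=∅ (All.lookup W.inside x∈W) Tp

      R-q-P-induced : ¬ Any (E r) (q ∷ P.first ∷ P.rest) →
        InducedPath (r ∷ R.first ∷ R.rest ++ q ∷ P.first ∷ P.rest)
      R-q-P-induced r-misses-P =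
        join r (R.first ∷ R.rest) q (P.first ∷ P.rest) R.induced P.induced (E-sym R.touches-last) far-q far
        where
        far-q : ∀ {x} → x ∈ r ∷ R.first ∷ R.rest → x ≢ lastOf R.first R.rest → Far x q
        far-q (here refl) _ = ≢-sym q≢r , ¬qr ∘′ E-sym
        far-q (there x∈R)   = R-far-q x∈R

        far : ∀ {x w} → x ∈ r ∷ R.first ∷ R.rest → w ∈ P.first ∷ P.rest → Far x w
        far (here refl) w∈ = apart T∉Y Tr (All.lookup P.inside w∈) , λ rw → r-misses-P (there (lose w∈ rw))
        far (there x∈R) w∈ = X-far-Y (All.lookup R.inside x∈R) (All.lookup P.inside w∈)

      centre-y : ¬ Any (E r) (q ∷ P.first ∷ P.rest) → ¬ Any (E p) (R.first ∷ R.rest) → ContainsPropeller G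
      centre-y r-misses-P p-misses-R =
        propeller hole y y∉C (here refl) (there (there (∈-++⁺ʳ (R.first ∷ R.rest) (here refl)))) p≢q yp yq
        where
        last-is-P : lastOf R.first (R.rest ++ q ∷ P.first ∷ P.rest) ≡ lastOf P.first P.rest
        last-is-P = lastOf-++ R.first R.rest q (P.first ∷ P.rest)

        hole : Hole p r (R.first ∷ R.rest ++ q ∷ P.first ∷ P.rest)
        hole = record
          { induced       = R-q-P-induced r-misses-P
          ; nontrivial    = λ ()
          ; apex-head     = pr
          ; apex-last     = subst (E p) (sym last-is-P) P.touches-last
          ; apex-interior = interior
          }
          where
          interior : ∀ {x} → x ∈ r ∷ R.first ∷ R.rest ++ q ∷ P.first ∷ P.rest → x ≢ r →
                     x ≢ lastOf R.first (R.rest ++ q ∷ P.first ∷ P.rest) → Far p x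
          interior (here refl) x≢r _ = ⊥-elim (x≢r refl)
          interior (there x∈) _ x≢last with ∈-++-∷⁻ (R.first ∷ R.rest) x∈
          ... | inj₁ x∈R         = apart T∉X Tp (All.lookup R.inside x∈R) , p-misses-R ∘′ lose x∈R
          ... | inj₂ (inj₁ refl) = p≢q , ¬pq
          ... | inj₂ (inj₂ x∈P)  = apart T∉Y Tp (All.lookup P.inside x∈P) ,
                                   λ px → x≢last (trans (P.touches-only-last x∈P px) (sym last-is-P))

        y∉C : ∀ {x} → x ∈ p ∷ r ∷ R.first ∷ R.rest ++ q ∷ P.first ∷ P.rest → x ≢ y
        y∉C (here refl)         = ≢-sym (E⇒≢ yp)
        y∉C (there (here refl)) = apart T∉X Tr Xy
        y∉C (there (there x∈)) with ∈-++-∷⁻ (R.first ∷ R.rest) x∈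
        ... | inj₁ x∈R         = λ { refl → p-misses-R (lose x∈R (E-sym yp)) }
        ... | inj₂ (inj₁ refl) = apart T∉X Tq Xy
        ... | inj₂ (inj₂ x∈P)  = apart Y∩X=∅ (All.lookup P.inside x∈P) Xy

      some-propeller : ContainsPropeller G
      some-propeller with Any.any? (E-dec r) (q ∷ P.first ∷ P.rest)
      ... | yes r-sees-P = let z , z∈ , rz = find r-sees-P in centre-r z∈ rz
      ... | no r-misses-P with Any.any? (E-dec p) (R.first ∷ R.rest)
      ...   | yes p-sees-R = let z , z∈ , pz = find p-sees-R in
                             centre-p (pathToward (T∉Y Tq) (Y-connects Tq Tr)) z∈ pz
      ...   | no p-misses-R = centre-y r-misses-P p-misses-R

    non-edge-case : ∀ {p q r y} → T p → T q → T r → X y → p ≢ q → q ≢ r →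
      E y p → E y q → ¬ E p q → E p r → ¬ E q r → ContainsPropeller G
    non-edge-case Tp Tq Tr Xy p≢q q≢r yp yq ¬pq pr ¬qr = NonEdgeCase.some-propeller
      Tp Tq Tr Xy p≢q q≢r yp yq ¬pq pr ¬qr
      (pathToward (T∉Y Tq) (Y-connects Tq Tp)) (pathToward (T∉X Tr) (X-connects Tr Tq))

    edge-and-isolated : ∀ {a b c y} → T a → T b → T c → X y → a ≢ c → b ≢ c →
      E a b → ¬ E a c → ¬ E b c → (E y a × E y b) ⊎ (E y c × (E y a ⊎ E y b)) → ContainsPropeller G
    edge-and-isolated Ta Tb Tc Xy a≢c b≢c ab ¬ac ¬bc (inj₁ (ya , yb)) = edge-case Ta Tb Xy ab ya yb
    edge-and-isolated Ta Tb Tc Xy a≢c b≢c ab ¬ac ¬bc (inj₂ (yc , inj₁ ya)) =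
      non-edge-case Ta Tc Tb Xy a≢c (≢-sym b≢c) ya yc ¬ac ab (¬bc ∘′ E-sym)
    edge-and-isolated Ta Tb Tc Xy a≢c b≢c ab ¬ac ¬bc (inj₂ (yc , inj₂ yb)) =
      non-edge-case Tb Tc Ta Xy b≢c (≢-sym a≢c) yb yc ¬bc (E-sym ab) (¬ac ∘′ E-sym)

  Among : V G → V G → V G → V G → Set
  Among u v w z = z ≡ u ⊎ z ≡ v ⊎ z ≡ w

  ≢-all⇒¬Among : ∀ {u v w z} → z ≢ u × z ≢ v × z ≢ w → ¬ Among u v w z
  ≢-all⇒¬Among (z≢u , z≢v , z≢w) = Sum.[ z≢u , Sum.[ z≢v , z≢w ] ]

  reach : ∀ {K u v w} (sees : ComponentSeesAll G K u v w) → ∀ {z} → Among u v w z →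
    Σ (V G) λ z′ → E z z′ × Walk G K (proj₁ sees) z′
  reach (a , b , c , Ka , _ , _ , ua , _  , _  , _  , _ ) (inj₁ refl)        = a , ua , here Ka
  reach (a , b , c , _  , _ , _ , _  , vb , _  , ab , _ ) (inj₂ (inj₁ refl)) = b , vb , ab
  reach (a , b , c , _  , _ , _ , _  , _  , wc , _  , ac) (inj₂ (inj₂ refl)) = c , wc , ac

  component⇒connectedVia : ∀ {K u v w} → ComponentSeesAll G K u v w →
    ∀ {s t} → Among u v w s → Among u v w t → ConnectedVia K s t
  component⇒connectedVia sees Ts Tt with reach sees Ts | reach sees Tt
  ... | s′ , ss′ , root-s′ | t′ , tt′ , root-t′ =
    s′ , t′ , ss′ , tt′ , walk-++ (walk-reverse root-s′) root-t′

  separation : ∀ {u v w} {X Y : V G → Set} →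
    (∀ x → X x → x ≢ u × x ≢ v × x ≢ w) → (∀ x → Y x → x ≢ u × x ≢ v × x ≢ w) →
    (∀ x → ¬ (X x × Y x)) → (∀ x y → X x → Y y → ¬ E x y) →
    ComponentSeesAll G X u v w → ComponentSeesAll G Y u v w → Separation (Among u v w) X Y
  separation X-out Y-out disjoint no-edge X-sees Y-sees = record
    { disjoint   = λ Xz Yz → disjoint _ (Xz , Yz)
    ; no-edge    = no-edge _ _
    ; T∉X        = λ Tz Xz → ≢-all⇒¬Among (X-out _ Xz) Tz
    ; T∉Y        = λ Tz Yz → ≢-all⇒¬Among (Y-out _ Yz) Tz
    ; X-connects = component⇒connectedVia X-sees
    ; Y-connects = component⇒connectedVia Y-sees
    }

  among₁ : ∀ {u v w} → Among u v w u
  among₁ = inj₁ refl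

  among₂ : ∀ {u v w} → Among u v w v
  among₂ = inj₂ (inj₁ refl)

  among₃ : ∀ {u v w} → Among u v w w
  among₃ = inj₂ (inj₂ refl)

  sees-two⇒propeller : ∀ {u v w X Y y} → Separation (Among u v w) X Y → u ≢ v → u ≢ w → v ≢ w →
    ExactlyOneEdge G u v w → X y → (E y u × E y v) ⊎ (E y u × E y w) ⊎ (E y v × E y w) →
    ContainsPropeller G
  sees-two⇒propeller S u≢v u≢w v≢w (inj₁ (uv , ¬uw , ¬vw)) Xy =
    edge-and-isolated S among₁ among₂ among₃ Xy u≢w v≢w uv ¬uw ¬vw ∘′ λ
      { (inj₁ (yu , yv))        → inj₁ (yu , yv)
      ; (inj₂ (inj₁ (yu , yw))) → inj₂ (yw , inj₁ yu)
      ; (inj₂ (inj₂ (yv , yw))) → inj₂ (yw , inj₂ yv) }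
  sees-two⇒propeller S u≢v u≢w v≢w (inj₂ (inj₁ (¬uv , uw , ¬vw))) Xy =
    edge-and-isolated S among₁ among₃ among₂ Xy u≢v (≢-sym v≢w) uw ¬uv (¬vw ∘′ E-sym) ∘′ λ
      { (inj₁ (yu , yv))        → inj₂ (yv , inj₁ yu)
      ; (inj₂ (inj₁ (yu , yw))) → inj₁ (yu , yw)
      ; (inj₂ (inj₂ (yv , yw))) → inj₂ (yv , inj₂ yw) }
  sees-two⇒propeller S u≢v u≢w v≢w (inj₂ (inj₂ (¬uv , ¬uw , vw))) Xy =
    edge-and-isolated S among₂ among₃ among₁ Xy (≢-sym u≢v) (≢-sym u≢w)
                      vw (¬uv ∘′ E-sym) (¬uw ∘′ E-sym) ∘′ λ
      { (inj₁ (yu , yv))        → inj₂ (yu , inj₁ yv)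
      ; (inj₂ (inj₁ (yu , yw))) → inj₂ (yu , inj₂ yw)
      ; (inj₂ (inj₂ (yv , yw))) → inj₁ (yv , yw) }

lemma4p9 : (G : Graph) → TwoConnected G → ¬ ContainsPropeller G → ¬ HasK2Cutset G →
    ∀ u v w → ICutset G u v w → ProperICutset G u v w
lemma4p9 G _ no-propeller _ u v w
  (u≢v , u≢w , v≢w , one-edge , K′ , K″ , partition , K′-out , K″-out ,
   disjoint , no-edge , K′-sees , K″-sees)
  y y≢u y≢v y≢w sees-two =
  Sum.[ ≢-all⇒¬Among G (y≢u , y≢v , y≢w)
      , no-propeller ∘′ Sum.[ on-side S , on-side (Separation-swap G S) ] ] (partition y)
  where
  S : Separation G (Among G u v w) K′ K″
  S = separation G K′-out K″-out disjoint no-edge K′-sees K″-sees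

  on-side : ∀ {X Y} → Separation G (Among G u v w) X Y → X y → ContainsPropeller G
  on-side S′ Xy = sees-two⇒propeller G S′ u≢v u≢w v≢w one-edge Xy sees-two
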